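{- Let $n\ge2$ and $(\rho,v)\in NC^{\mathrm{(mton)}}_2(2n-2)$, and let $C^{(\mathrm{pair})}(\rho,v)\subseteq NC^{\mathrm{(mton)}}_2(2n)$ be the set of its children. Then $$\sum_{(\pi,u)\in C^{(\mathrm{pair})}(\rho,v)} A_n(\pi,u) = (2n-1) + (2n+1)\,A_{n-1}(\rho,v),$$ where $A_n(\pi,u):=\mathrm{area}(\pi)$.
   Context: $NC_2(2n)$: non-crossing pair-partitions of $\{1,\ldots,2n\}$. For blocks $V,W$, "$V$ nested inside $W$" means $\min V>\min W$ and $\max V<\max W$. A monotonic ordering of $\pi\in NC_2(2n)$ is a bijection $u:\pi\to\{1,\ldots,n\}$ with $u(V)>u(W)$ whenever $V$ is nested inside $W$; $NC^{\mathrm{(mton)}}_2(2n)$ is the set of such pairs $(\pi,u)$. $J(\pi,u):=u^{ -1}(n)$, of the form $\{m,m+1\}$. For $n\ge2$ the pair-parent $\mathfrak{pp}(\pi,u)=(\rho,v)\in NC^{\mathrm{(mton)}}_2(2n-2)$: with $J(\pi,u)=\{m,m+1\}$ and $\phi$ the increasing bijection from $\{1,\ldots,2n-2\}$ onto $\{1,\ldots,2n\}\setminus\{m,m+1\}$, $\rho=\{\{p,q\} : \{\phi(p),\phi(q)\}\in\pi\}$ and $v(\{p,q\}) = u(\{\phi(p),\phi(q)\})$. The children of $(\rho,v)$ are $C^{(\mathrm{pair})}(\rho,v):=\{(\pi,u)\in NC^{\mathrm{(mton)}}_2(2n) : \mathfrak{pp}(\pi,u)=(\rho,v)\}$. For $\pi\in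 NC_2(2n)$, $f_\pi:[0,2n]\to\mathbb{R}$ is the continuous function with $f_\pi(0)=0$, linear on each $[m-1,m]$, with slope $+1$ on $[i-1,i]$ and $-1$ on $[j-1,j]$ for every pair $\{i,j\}\in\pi$, $i<j$; $\mathrm{area}(\pi):=\int_0^{2n}f_\pi(t)\,dt$. -}

module Defs where

open import Data.Nat using (ℕ; zero; suc; _+_; _*_; _∸_; _≤_; _<_; _<ᵇ_; _≡ᵇ_)
open import Data.Bool using (Bool; true; false; if_then_else_)
open import Data.Integer using (ℤ; +_) renaming (_+_ to _+ℤ_; _-_ to _-ℤ_)
open import Data.Fin using (Fin; toℕ)
open import Data.Vec using (Vec; []; _∷_; lookup; map; init; last; foldr)
open import Data.Product using (_×_; _,_; proj₁; proj₂; ∃-syntax)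
open import Data.Sum using (_⊎_)
open import Relation.Binary.PropositionalEquality using (_≡_)
open import Relation.Nullary using (¬_)

-- Points of {1,…,2n} are natural numbers; a block {i,j} with i<j is stored as (i , j).
Pair : Set
Pair = ℕ × ℕ

-- A pair-partition π of {1,…,2n} together with a bijection u : π → {1,…,n}
-- is encoded canonically as a vector bs of length n whose entry at index k
-- (k = 0,…,n-1) is the block u⁻¹(k+1).  Equality of encodings = equality of (π,u).
Labelled : ℕ → Set
Labelled n = Vec Pair n

_∈B_ : ℕ → Pair → Set
x ∈B (i , j) = (x ≡ i) ⊎ (x ≡ j)

IsPairPartition : (n : ℕ) → Labelled n → Set
IsPairPartition n bs =
  (∀ (k : Fin n) → 1 ≤ proj₁ (lookup bs k)
                 × proj₁ (lookup bs k) < proj₂ (lookup bs k)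
                 × proj₂ (lookup bs k) ≤ 2 * n)
  × (∀ (x : ℕ) → 1 ≤ x → x ≤ 2 * n → ∃[ k ] (x ∈B lookup bs k))
  × (∀ (x : ℕ) (k k′ : Fin n) → x ∈B lookup bs k → x ∈B lookup bs k′ → k ≡ k′)

Crossing : Pair → Pair → Set
Crossing (a , b) (c , d) = a < c × c < b × b < d

NonCrossing : (n : ℕ) → Labelled n → Set
NonCrossing n bs = ∀ (k k′ : Fin n) → ¬ Crossing (lookup bs k) (lookup bs k′)

NestedIn : Pair → Pair → Set
NestedIn (a , b) (c , d) = c < a × b < d

Monotonic : (n : ℕ) → Labelled n → Set
Monotonic n bs = ∀ (k k′ : Fin n) → NestedIn (lookup bs k) (lookup bs k′) → toℕ k′ < toℕ k

NCmton : (n : ℕ) → Labelled n → Set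
NCmton n bs = IsPairPartition n bs × NonCrossing n bs × Monotonic n bs

-- J(π,u) = u⁻¹(n) = last bs = {m, m+1}.  φ : {1..2n-2} → {1..2n}∖{m,m+1}
-- is increasing, φ p = p for p < m, φ p = p + 2 for p ≥ m; its inverse on
-- {1..2n}∖{m,m+1} is φinv below.  ρ's block labelled k (k < n) is φ⁻¹ of π's block labelled k.
φinv : ℕ → ℕ → ℕ
φinv m x = if x <ᵇ m then x else x ∸ 2

pp : {k : ℕ} → Labelled (suc k) → Labelled k
pp bs = map (λ { (i , j) → (φinv m i , φinv m j) }) (init bs)
  where m = proj₁ (last bs)

-- f_π as integer heights at integer points: f(0)=0, f(t) = f(t-1) + slope of [t-1,t],
-- slope = +1 if t is the smaller element of a block, −1 if the larger.
slope : {n : ℕ} → Labelled n → ℕ → ℤ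
slope bs t = foldr _ (λ { (i , j) acc →
                 acc +ℤ ((if i ≡ᵇ t then + 1 else + 0) -ℤ (if j ≡ᵇ t then + 1 else + 0)) })
               (+ 0) bs

height : {n : ℕ} → Labelled n → ℕ → ℤ
height bs zero = + 0
height bs (suc t) = height bs t +ℤ slope bs (suc t)

sumTo : ℕ → (ℕ → ℤ) → ℤ
sumTo zero g = + 0
sumTo (suc N) g = sumTo N g +ℤ g (suc N)

-- 2·area(π) = 2 ∫₀^{2n} f_π = Σ_{t=1}^{2n} (f(t-1) + f(t))   (exact: f_π is linear on each [t-1,t])
twiceArea : (n : ℕ) → Labelled n → ℤ
twiceArea n bs = sumTo (2 * n) (λ t → height bs (t ∸ 1) +ℤ height bs t)

open import Data.List using (List) renaming (foldr to foldrL)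

sumℤ : List ℤ → ℤ
sumℤ = foldrL _+ℤ_ (+ 0)

{-# OPTIONS --safe #-}
-- No block is nested in the block of (π, u) with the largest label (monotonicity) and none
-- crosses it, so it contains no point: it is an adjacent block {m, m+1}.  Hence the children
-- of (ρ, v) are exactly the insertions of {m, m+1}, m = 1, …, 2n−1, with the other points
-- relabelled by φ.  On the path f_ρ such an insertion adds an up-down tent at height
-- h = f_ρ(m−1) and shifts the rest by two steps, so twice the area grows by the two new
-- trapezoids, (h + (h+1)) + ((h+1) + h) = 4h + 2.  Summing over m gives
-- (2n−1)·2A + 4·Σ_t f_ρ(t) + 2(2n−1), and Σ_t f_ρ(t) = A because f_ρ vanishes at both ends.
module Submission where

open import Defs
open import Data.Bool using (Bool; if_then_else_)
open import Data.Empty using (⊥; ⊥-elim)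
open import Data.Fin using (Fin; toℕ; inject₁; fromℕ) renaming (zero to fzero; suc to fsuc)
import Data.Fin.Properties as Fin
open import Data.Fin.Properties using (toℕ-inject₁; toℕ-fromℕ; toℕ<n; fromℕ≢inject₁)
open import Data.Integer using (ℤ; +_; _+_; _*_; _-_; -_)
import Data.Integer.Properties as ℤ
open import Data.Integer.Tactic.RingSolver using (solve-∀)
open import Data.List using (List; map; applyDownFrom)
open import Data.List.Membership.Propositional using (_∈_)
open import Data.List.Membership.Propositional.Properties using (∈-applyDownFrom⁺; ∈-applyDownFrom⁻)
open import Data.List.Membership.Propositional.Properties.WithK using (unique∧set⇒bag)
open import Data.List.Relation.Binary.BagAndSetEquality using (∼bag⇒↭)
open import Data.List.Relation.Binary.Permutation.Propositional using (_↭_; ↭⇒↭ₛ)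
import Data.List.Relation.Binary.Permutation.Propositional.Properties as ↭
open import Data.List.Relation.Binary.Permutation.Setoid.Properties using (foldr-commMonoid)
open import Data.List.Relation.Unary.Unique.Propositional using (Unique)
open import Data.List.Relation.Unary.Unique.Propositional.Properties using (applyDownFrom⁺₁)
open import Data.Nat using (ℕ; zero; suc; _∸_; _≤_; _<_; _<ᵇ_; _≡ᵇ_; z≤n; s≤s; _≟_; _<?_)
  renaming (_*_ to _*ℕ_)
open import Data.Nat.Properties
open import Data.Product using (_×_; _,_; proj₁; proj₂; ∃-syntax; uncurry)
open import Data.Sum using (inj₁; inj₂; [_,_]′)
open import Data.Vec using (Vec; []; _∷_; lookup; init; last; _∷ʳ_; initLast)
  renaming (map to mapᵥ)
open import Data.Vec.Properties using (init-∷ʳ; last-∷ʳ; lookup-map; map-∘; map-id; map-cong; ∷ʳ-injectiveʳ)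
open import Function.Base using (_∘_; id)
open import Function.Bundles using (_⇔_; mk⇔)
open import Function.Properties.Equivalence using () renaming (sym to ⇔-sym; trans to ⇔-trans)
open import Relation.Binary.Definitions using (tri<; tri≈; tri>)
open import Relation.Binary.PropositionalEquality
open import Relation.Nullary using (¬_; yes; no)
open import Relation.Nullary.Decidable using (dec-true; dec-false; does-⇔)

private variable
  k n m x : ℕ

data SnocView : ∀ {n} → Fin (suc n) → Set where
  old : (i : Fin n) → SnocView (inject₁ i)
  new : SnocView (fromℕ n)

snocView : (j : Fin (suc n)) → SnocView j
snocView {zero}  fzero    = new
snocView {suc n} fzero    = old fzero
snocView {suc n} (fsuc j) with snocView j
... | old i = old (fsuc i)
... | new   = new

lookup-∷ʳ-inject₁ : ∀ {A : Set} (xs : Vec A n) (z : A) (i : Fin n) → lookup (xs ∷ʳ z) (inject₁ i) ≡ lookup xs i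
lookup-∷ʳ-inject₁ (x ∷ xs) z fzero    = refl
lookup-∷ʳ-inject₁ (x ∷ xs) z (fsuc i) = lookup-∷ʳ-inject₁ xs z i

lookup-∷ʳ-fromℕ : ∀ {A : Set} (xs : Vec A n) (z : A) → lookup (xs ∷ʳ z) (fromℕ n) ≡ z
lookup-∷ʳ-fromℕ []       z = refl
lookup-∷ʳ-fromℕ (x ∷ xs) z = lookup-∷ʳ-fromℕ xs z

-- shift m is the map φ of the pair-parent construction, extended to all of ℕ.
shift : ℕ → ℕ → ℕ
shift m x = if x <ᵇ m then x else suc (suc x)

shift-< : x < m → shift m x ≡ x
shift-< {x} {m} x<m = cong (if_then x else suc (suc x)) (dec-true (x <? m) x<m)

shift-≥ : m ≤ x → shift m x ≡ suc (suc x)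
shift-≥ {m} {x} m≤x = cong (if_then x else suc (suc x)) (dec-false (x <? m) (≤⇒≯ m≤x))

φinv-< : x < m → φinv m x ≡ x
φinv-< {x} {m} x<m = cong (if_then x else x ∸ 2) (dec-true (x <? m) x<m)

φinv-≥ : m ≤ x → φinv m x ≡ x ∸ 2
φinv-≥ {m} {x} m≤x = cong (if_then x else x ∸ 2) (dec-false (x <? m) (≤⇒≯ m≤x))

φinv-shift : ∀ m x → φinv m (shift m x) ≡ x
φinv-shift m x with x <? m
... | yes x<m = trans (cong (φinv m) (shift-< x<m)) (φinv-< x<m)
... | no x≮m  = trans (cong (φinv m) (shift-≥ (≮⇒≥ x≮m))) (φinv-≥ (≤-trans (≮⇒≥ x≮m) (m≤n+m x 2)))

shift-φinv : x ≢ m → x ≢ suc m → shift m (φinv m x) ≡ x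
shift-φinv {x} {m} x≢m x≢1+m with x <? m
... | yes x<m = trans (cong (shift m) (φinv-< x<m)) (shift-< x<m)
... | no x≮m with ≤∧≢⇒< (≤∧≢⇒< (≮⇒≥ x≮m) (x≢m ∘ sym)) (x≢1+m ∘ sym)
...   | s≤s (s≤s m≤y) = trans (cong (shift m) (φinv-≥ (≤-trans m≤y (m≤n+m _ 2)))) (shift-≥ m≤y)

shift-<-mono : ∀ m {a c} → a < c → shift m a < shift m c
shift-<-mono m {a} {c} a<c with a <? m | c <? m
... | yes a<m | yes c<m rewrite shift-< a<m | shift-< c<m = a<c
... | yes a<m | no c≮m  rewrite shift-< a<m | shift-≥ (≮⇒≥ c≮m) = ≤-trans a<c (m≤n+m c 2)
... | no a≮m  | yes c<m = ⊥-elim (a≮m (<-trans a<c c<m))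
... | no a≮m  | no c≮m  rewrite shift-≥ (≮⇒≥ a≮m) | shift-≥ (≮⇒≥ c≮m) = s≤s (s≤s a<c)

shift-<-cancel : ∀ m {a c} → shift m a < shift m c → a < c
shift-<-cancel m {a} {c} lt with <-cmp a c
... | tri< a<c _ _ = a<c
... | tri≈ _ refl _ = ⊥-elim (<-irrefl refl lt)
... | tri> _ _ c<a = ⊥-elim (<-asym lt (shift-<-mono m c<a))

shift-injective : ∀ m {a c} → shift m a ≡ shift m c → a ≡ c
shift-injective m {a} {c} eq with <-cmp a c
... | tri< a<c _ _ = ⊥-elim (<-irrefl eq (shift-<-mono m a<c))
... | tri≈ _ a≡c _ = a≡c
... | tri> _ _ c<a = ⊥-elim (<-irrefl (sym eq) (shift-<-mono m c<a))

shift≢ : ∀ m a → shift m a ≢ m × shift m a ≢ suc m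
shift≢ m a with a <? m
... | yes a<m rewrite shift-< a<m = <⇒≢ a<m , <⇒≢ (≤-trans a<m (n≤1+n m))
... | no a≮m  rewrite shift-≥ (≮⇒≥ a≮m) = ≢-sym (<⇒≢ (s≤s (≤-trans (≮⇒≥ a≮m) (n≤1+n a))))
                                           , ≢-sym (<⇒≢ (s≤s (s≤s (≮⇒≥ a≮m))))

shift-mapsTo : 0 < m → m ≤ suc n → 1 ≤ x → x ≤ n → 1 ≤ shift m x × shift m x ≤ suc (suc n)
shift-mapsTo {m} 0<m m≤1+n 1≤x x≤n =
  subst (_< shift m _) (shift-< 0<m) (shift-<-mono m 1≤x) ,
  ≤-pred (subst (shift m _ <_) (shift-≥ m≤1+n) (shift-<-mono m (s≤s x≤n)))

shift-mapsTo⁻ : 0 < m → m ≤ suc n → 1 ≤ shift m x → shift m x ≤ suc (suc n) → 1 ≤ x × x ≤ n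
shift-mapsTo⁻ {m} 0<m m≤1+n 1≤shift shift≤ =
  shift-<-cancel m (subst (_< shift m _) (sym (shift-< 0<m)) 1≤shift) ,
  ≤-pred (shift-<-cancel m (subst (shift m _ <_) (sym (shift-≥ m≤1+n)) (s≤s shift≤)))

-- Inserting the adjacent block {m, m+1}

shiftBlock : ℕ → Pair → Pair
shiftBlock m p = (shift m (proj₁ p) , shift m (proj₂ p))

child : ℕ → Labelled k → Labelled (suc k)
child m ρ = mapᵥ (shiftBlock m) ρ ∷ʳ (m , suc m)

lookup-child-old : (m : ℕ) (ρ : Labelled k) (i : Fin k) → lookup (child m ρ) (inject₁ i) ≡ shiftBlock m (lookup ρ i)
lookup-child-old m ρ i = trans (lookup-∷ʳ-inject₁ (mapᵥ (shiftBlock m) ρ) (m , suc m) i) (lookup-map i (shiftBlock m) ρ)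

lookup-child-new : (m : ℕ) (ρ : Labelled k) → lookup (child m ρ) (fromℕ k) ≡ (m , suc m)
lookup-child-new m ρ = lookup-∷ʳ-fromℕ (mapᵥ (shiftBlock m) ρ) (m , suc m)

BlockWithin : ℕ → Pair → Set
BlockWithin N p = 1 ≤ proj₁ p × proj₁ p < proj₂ p × proj₂ p ≤ N

shiftBlock-within : 0 < m → m ≤ suc n → (p : Pair) → BlockWithin n p → BlockWithin (suc (suc n)) (shiftBlock m p)
shiftBlock-within {m} 0<m m≤1+n (a , b) (1≤a , a<b , b≤n) =
  proj₁ (shift-mapsTo 0<m m≤1+n 1≤a (≤-trans (<⇒≤ a<b) b≤n)) ,
  shift-<-mono m a<b ,
  proj₂ (shift-mapsTo 0<m m≤1+n (≤-trans 1≤a (<⇒≤ a<b)) b≤n)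

adjacent-within : 0 < m → m ≤ suc n → BlockWithin (suc (suc n)) (m , suc m)
adjacent-within {m} 0<m m≤1+n = 0<m , n<1+n m , s≤s m≤1+n

∈B-shiftBlock⁺ : ∀ m p → x ∈B p → shift m x ∈B shiftBlock m p
∈B-shiftBlock⁺ m p (inj₁ refl) = inj₁ refl
∈B-shiftBlock⁺ m p (inj₂ refl) = inj₂ refl

∈B-shiftBlock⁻ : ∀ m p → x ∈B shiftBlock m p → ∃[ a ] x ≡ shift m a × a ∈B p
∈B-shiftBlock⁻ m p (inj₁ x≡) = proj₁ p , x≡ , inj₁ refl
∈B-shiftBlock⁻ m p (inj₂ x≡) = proj₂ p , x≡ , inj₂ refl

shiftBlock-∉-adjacent : ∀ m p → x ∈B shiftBlock m p → ¬ x ∈B (m , suc m)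
shiftBlock-∉-adjacent m p x∈ x∈′ with ∈B-shiftBlock⁻ m p x∈
... | a , refl , _ with x∈′
...   | inj₁ eq = proj₁ (shift≢ m a) eq
...   | inj₂ eq = proj₂ (shift≢ m a) eq

shiftBlock-crossing⁻ : ∀ m p q → Crossing (shiftBlock m p) (shiftBlock m q) → Crossing p q
shiftBlock-crossing⁻ m (a , b) (c , d) (a<c , c<b , b<d) =
  shift-<-cancel m a<c , shift-<-cancel m c<b , shift-<-cancel m b<d

shiftBlock-nestedIn⁻ : ∀ m p q → NestedIn (shiftBlock m p) (shiftBlock m q) → NestedIn p q
shiftBlock-nestedIn⁻ m (a , b) (c , d) (c<a , b<d) = shift-<-cancel m c<a , shift-<-cancel m b<d

adjacent-¬crossingˡ : ∀ m q → ¬ Crossing (m , suc m) q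
adjacent-¬crossingˡ m (c , d) (m<c , c<1+m , _) = <⇒≱ m<c (≤-pred c<1+m)

adjacent-¬crossingʳ : ∀ m p → ¬ Crossing p (m , suc m)
adjacent-¬crossingʳ m (a , b) (_ , m<b , b<1+m) = <⇒≱ m<b (≤-pred b<1+m)

adjacent-¬nestedIn : ∀ m p → proj₁ p < proj₂ p → ¬ NestedIn p (m , suc m)
adjacent-¬nestedIn m (c , d) c<d (m<c , d<1+m) = <⇒≱ (<-trans m<c c<d) (≤-pred d<1+m)

module _ {k : ℕ} (ρ : Labelled k) (ncρ : NCmton k ρ) {m : ℕ} (0<m : 0 < m) (m≤ : m ≤ suc (2 *ℕ k)) where

  private
    within : ∀ i → BlockWithin (2 *ℕ k) (lookup ρ i)
    within = proj₁ (proj₁ ncρ)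
    covers : ∀ x → 1 ≤ x → x ≤ 2 *ℕ k → ∃[ i ] x ∈B lookup ρ i
    covers = proj₁ (proj₂ (proj₁ ncρ))
    disjoint : ∀ x i i′ → x ∈B lookup ρ i → x ∈B lookup ρ i′ → i ≡ i′
    disjoint = proj₂ (proj₂ (proj₁ ncρ))
    nonCrossing : NonCrossing k ρ
    nonCrossing = proj₁ (proj₂ ncρ)
    monotonic : Monotonic k ρ
    monotonic = proj₂ (proj₂ ncρ)

  child-within : ∀ j → BlockWithin (2 *ℕ suc k) (lookup (child m ρ) j)
  child-within j rewrite *-suc 2 k with snocView j
  ... | old i rewrite lookup-child-old m ρ i = shiftBlock-within 0<m m≤ (lookup ρ i) (within i)
  ... | new   rewrite lookup-child-new m ρ   = adjacent-within 0<m m≤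

  child-covers : ∀ x → 1 ≤ x → x ≤ 2 *ℕ suc k → ∃[ j ] x ∈B lookup (child m ρ) j
  child-covers x 1≤x x≤ with x ≟ m | x ≟ suc m
  ... | yes x≡m | _       = fromℕ k , subst (x ∈B_) (sym (lookup-child-new m ρ)) (inj₁ x≡m)
  ... | no _    | yes x≡m = fromℕ k , subst (x ∈B_) (sym (lookup-child-new m ρ)) (inj₂ x≡m)
  ... | no x≢m  | no x≢1+m =
    let shift-y≡x  = shift-φinv x≢m x≢1+m
        1≤y , y≤2k = shift-mapsTo⁻ 0<m m≤ (subst (1 ≤_) (sym shift-y≡x) 1≤x)
                                          (subst (_≤ _) (sym shift-y≡x) (subst (x ≤_) (*-suc 2 k) x≤))
        i , y∈     = covers (φinv m x) 1≤y y≤2k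
    in inject₁ i , subst₂ _∈B_ shift-y≡x (sym (lookup-child-old m ρ i)) (∈B-shiftBlock⁺ m (lookup ρ i) y∈)

  child-disjoint : ∀ x j j′ → x ∈B lookup (child m ρ) j → x ∈B lookup (child m ρ) j′ → j ≡ j′
  child-disjoint x j j′ x∈ x∈′ with snocView j | snocView j′
  ... | old i | old i′ =
    let a  , x≡  , a∈  = ∈B-shiftBlock⁻ m _ (subst (x ∈B_) (lookup-child-old m ρ i) x∈)
        a′ , x≡′ , a∈′ = ∈B-shiftBlock⁻ m _ (subst (x ∈B_) (lookup-child-old m ρ i′) x∈′)
        a≡a′           = shift-injective m (trans (sym x≡) x≡′)
    in cong inject₁ (disjoint a i i′ a∈ (subst (_∈B _) (sym a≡a′) a∈′))
  ... | old i | new = ⊥-elim (shiftBlock-∉-adjacent m (lookup ρ i)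
                        (subst (x ∈B_) (lookup-child-old m ρ i) x∈) (subst (x ∈B_) (lookup-child-new m ρ) x∈′))
  ... | new | old i = ⊥-elim (shiftBlock-∉-adjacent m (lookup ρ i)
                        (subst (x ∈B_) (lookup-child-old m ρ i) x∈′) (subst (x ∈B_) (lookup-child-new m ρ) x∈))
  ... | new | new = refl

  child-nonCrossing : NonCrossing (suc k) (child m ρ)
  child-nonCrossing j j′ with snocView j | snocView j′
  ... | old i | old i′ rewrite lookup-child-old m ρ i | lookup-child-old m ρ i′ =
    nonCrossing i i′ ∘ shiftBlock-crossing⁻ m (lookup ρ i) (lookup ρ i′)
  ... | old i | new rewrite lookup-child-new m ρ = adjacent-¬crossingʳ m _
  ... | new   | _   rewrite lookup-child-new m ρ = adjacent-¬crossingˡ m _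

  child-monotonic : Monotonic (suc k) (child m ρ)
  child-monotonic j j′ with snocView j | snocView j′
  ... | old i | old i′ rewrite lookup-child-old m ρ i | lookup-child-old m ρ i′ | toℕ-inject₁ i | toℕ-inject₁ i′ =
    monotonic i i′ ∘ shiftBlock-nestedIn⁻ m (lookup ρ i) (lookup ρ i′)
  ... | old i | new rewrite lookup-child-old m ρ i | lookup-child-new m ρ =
    ⊥-elim ∘ adjacent-¬nestedIn m _ (shift-<-mono m (proj₁ (proj₂ (within i))))
  ... | new | old i′ rewrite toℕ-inject₁ i′ | toℕ-fromℕ k = λ _ → toℕ<n i′
  ... | new | new rewrite lookup-child-new m ρ = ⊥-elim ∘ adjacent-¬nestedIn m _ (n<1+n m)

  child-NCmton : NCmton (suc k) (child m ρ)
  child-NCmton = (child-within , child-covers , child-disjoint) , child-nonCrossing , child-monotonic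

-- Every child is such an insertion

endpoint-inside⇒nestedIn : ∀ p q → (∀ y → y ∈B p → ¬ y ∈B q) → ¬ Crossing p q → ¬ Crossing q p →
                           x ∈B p → proj₁ q < x → x < proj₂ q → NestedIn p q
endpoint-inside⇒nestedIn (c , d) (a , b) disj ¬p⋈q ¬q⋈p (inj₁ refl) a<c c<b with <-cmp d b
... | tri< d<b _ _  = a<c , d<b
... | tri≈ _ refl _ = ⊥-elim (disj d (inj₂ refl) (inj₂ refl))
... | tri> _ _ b<d  = ⊥-elim (¬q⋈p (a<c , c<b , b<d))
endpoint-inside⇒nestedIn (c , d) (a , b) disj ¬p⋈q ¬q⋈p (inj₂ refl) a<d d<b with <-cmp c a
... | tri< c<a _ _  = ⊥-elim (¬p⋈q (c<a , a<d , d<b))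
... | tri≈ _ refl _ = ⊥-elim (disj c (inj₁ refl) (inj₁ refl))
... | tri> _ _ a<c  = a<c , d<b

lastBlock-hollow : ∀ {bs : Labelled (suc k)} → NCmton (suc k) bs →
                   proj₁ (lookup bs (fromℕ k)) < x → x < proj₂ (lookup bs (fromℕ k)) → ⊥
lastBlock-hollow {k} {x} {bs} ((within , covers , disjoint) , nonCrossing , monotonic) a<x x<b
  with covers x (≤-trans (s≤s z≤n) a<x) (≤-trans (<⇒≤ x<b) (proj₂ (proj₂ (within (fromℕ k)))))
... | j , x∈ with j Fin.≟ fromℕ k
...   | yes refl = [ <⇒≢ a<x ∘ sym , <⇒≢ x<b ]′ x∈
...   | no j≢last = <⇒≱ (monotonic j (fromℕ k) nested) (subst (toℕ j ≤_) (sym (toℕ-fromℕ k)) (≤-pred (toℕ<n j)))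
  where
  nested : NestedIn (lookup bs j) (lookup bs (fromℕ k))
  nested = endpoint-inside⇒nestedIn (lookup bs j) (lookup bs (fromℕ k))
             (λ y y∈j y∈last → j≢last (disjoint y j (fromℕ k) y∈j y∈last))
             (nonCrossing j (fromℕ k)) (nonCrossing (fromℕ k) j) x∈ a<x x<b

φinvBlock : ℕ → Pair → Pair
φinvBlock m p = (φinv m (proj₁ p) , φinv m (proj₂ p))

pp-≗ : (bs : Labelled (suc k)) → pp bs ≡ mapᵥ (φinvBlock (proj₁ (last bs))) (init bs)
pp-≗ bs = map-cong (λ { (i , j) → refl }) (init bs)

pp-∷ʳ : (ys : Labelled k) (z : Pair) → pp (ys ∷ʳ z) ≡ mapᵥ (φinvBlock (proj₁ z)) ys
pp-∷ʳ ys z = trans (pp-≗ (ys ∷ʳ z)) (cong₂ (mapᵥ ∘ φinvBlock ∘ proj₁) (last-∷ʳ z ys) (init-∷ʳ z ys))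

pp-child : ∀ m (ρ : Labelled k) → pp (child m ρ) ≡ ρ
pp-child m ρ = begin
    pp (child m ρ)
  ≡⟨ pp-∷ʳ (mapᵥ (shiftBlock m) ρ) (m , suc m) ⟩
    mapᵥ (φinvBlock m) (mapᵥ (shiftBlock m) ρ)
  ≡⟨ map-∘ (φinvBlock m) (shiftBlock m) ρ ⟨
    mapᵥ (φinvBlock m ∘ shiftBlock m) ρ
  ≡⟨ map-cong (λ p → cong₂ _,_ (φinv-shift m (proj₁ p)) (φinv-shift m (proj₂ p))) ρ ⟩
    mapᵥ id ρ
  ≡⟨ map-id ρ ⟩
    ρ
  ∎
  where open ≡-Reasoning

map-shiftBlock-φinvBlock : ∀ m (ys : Vec Pair n) → (∀ i x → x ∈B lookup ys i → x ≢ m × x ≢ suc m) →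
                           mapᵥ (shiftBlock m) (mapᵥ (φinvBlock m) ys) ≡ ys
map-shiftBlock-φinvBlock m []             avoids = refl
map-shiftBlock-φinvBlock m ((i , j) ∷ ys) avoids =
  cong₂ _∷_ (cong₂ _,_ (uncurry shift-φinv (avoids fzero i (inj₁ refl))) (uncurry shift-φinv (avoids fzero j (inj₂ refl))))
            (map-shiftBlock-φinvBlock m ys (λ i → avoids (fsuc i)))

lastBlock-adjacent : ∀ {bs : Labelled (suc k)} → NCmton (suc k) bs →
                     proj₂ (lookup bs (fromℕ k)) ≡ suc (proj₁ (lookup bs (fromℕ k)))
lastBlock-adjacent {k} {bs} h@((within , _) , _) =
  ≤-antisym (≮⇒≥ (lastBlock-hollow {bs = bs} h (n<1+n _))) (proj₁ (proj₂ (within (fromℕ k))))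

lastBlock-∷ʳ : ∀ (ys : Labelled k) a b → NCmton (suc k) (ys ∷ʳ (a , b)) → b ≡ suc a × BlockWithin (2 *ℕ suc k) (a , b)
lastBlock-∷ʳ {k} ys a b h@((within , _) , _) =
  subst (λ q → proj₂ q ≡ suc (proj₁ q) × BlockWithin (2 *ℕ suc k) q) (lookup-∷ʳ-fromℕ ys (a , b))
        (lastBlock-adjacent {bs = ys ∷ʳ (a , b)} h , within (fromℕ k))

∷ʳ-preimage : (ys : Labelled k) (z : Pair) → NCmton (suc k) (ys ∷ʳ z) →
              ∃[ p ] p ≤ 2 *ℕ k × ys ∷ʳ z ≡ child (suc p) (mapᵥ (φinvBlock (proj₁ z)) ys)
∷ʳ-preimage {k} ys (a , b) h@((_ , _ , disjoint) , _) with lastBlock-∷ʳ ys a b h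
... | refl , s≤s {n = p} z≤n , _ , 2+p≤ =
  p , ≤-pred (≤-pred (subst (suc (suc p) ≤_) (*-suc 2 k) 2+p≤)) ,
  cong (_∷ʳ (suc p , suc (suc p))) (sym (map-shiftBlock-φinvBlock (suc p) ys avoids))
  where
  avoids : ∀ i x → x ∈B lookup ys i → x ≢ suc p × x ≢ suc (suc p)
  avoids i x x∈ = (λ x≡ → separate (inj₁ x≡)) , (λ x≡ → separate (inj₂ x≡))
    where
    separate : ¬ x ∈B (suc p , suc (suc p))
    separate x∈last = fromℕ≢inject₁ (disjoint x (fromℕ k) (inject₁ i)
                        (subst (x ∈B_) (sym (lookup-∷ʳ-fromℕ ys _)) x∈last)
                        (subst (x ∈B_) (sym (lookup-∷ʳ-inject₁ ys _ i)) x∈))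

pp-preimage : ∀ {bs : Labelled (suc k)} → NCmton (suc k) bs → ∃[ p ] p ≤ 2 *ℕ k × bs ≡ child (suc p) (pp bs)
pp-preimage {k} {bs} h =
  let p , p≤2k , bs≡ = ∷ʳ-preimage (init bs) (last bs) (subst (NCmton (suc k)) bs≡init∷ʳlast h)
  in p , p≤2k , trans bs≡init∷ʳlast (trans bs≡ (cong (child (suc p)) (sym (pp-≗ bs))))
  where
  bs≡init∷ʳlast : bs ≡ init bs ∷ʳ last bs
  bs≡init∷ʳlast = proj₂ (proj₂ (initLast bs))

children : Labelled k → List (Labelled (suc k))
children {k} ρ = applyDownFrom (λ p → child (suc p) ρ) (suc (2 *ℕ k))

∈-children⇔ : ∀ {ρ : Labelled k} → NCmton k ρ → ∀ bs → bs ∈ children ρ ⇔ (NCmton (suc k) bs × pp bs ≡ ρ)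
∈-children⇔ {k} {ρ} ncρ bs = mk⇔ to from
  where
  to : bs ∈ children ρ → NCmton (suc k) bs × pp bs ≡ ρ
  to bs∈ with ∈-applyDownFrom⁻ (λ p → child (suc p) ρ) bs∈
  ... | p , p<1+2k , refl = child-NCmton ρ ncρ (s≤s z≤n) p<1+2k , pp-child (suc p) ρ
  from : NCmton (suc k) bs × pp bs ≡ ρ → bs ∈ children ρ
  from (nc , refl) with pp-preimage nc
  ... | p , p≤2k , bs≡ =
    subst (_∈ children (pp bs)) (sym bs≡) (∈-applyDownFrom⁺ (λ p → child (suc p) (pp bs)) (s≤s p≤2k))

children-unique : (ρ : Labelled k) → Unique (children ρ)
children-unique {k} ρ = applyDownFrom⁺₁ (λ p → child (suc p) ρ) (suc (2 *ℕ k))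
  (λ j<i _ eq → <⇒≢ j<i (sym (suc-injective (cong proj₁ (∷ʳ-injectiveʳ _ _ eq)))))

indicator : Bool → ℤ
indicator b = if b then + 1 else + 0

blockSlope : Pair → ℕ → ℤ
blockSlope p t = indicator (proj₁ p ≡ᵇ t) - indicator (proj₂ p ≡ᵇ t)

blockSlope-≡ : ∀ p t {b b′} → (proj₁ p ≡ᵇ t) ≡ b → (proj₂ p ≡ᵇ t) ≡ b′ → blockSlope p t ≡ indicator b - indicator b′
blockSlope-≡ p t e e′ = cong₂ _-_ (cong indicator e) (cong indicator e′)

trapezoid : Labelled n → ℕ → ℤ
trapezoid bs t = height bs (t ∸ 1) + height bs t

sumℤ-↭ : ∀ {xs ys : List ℤ} → xs ↭ ys → sumℤ xs ≡ sumℤ ys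
sumℤ-↭ xs↭ys = foldr-commMonoid (setoid ℤ) ℤ.+-0-isCommutativeMonoid (↭⇒↭ₛ xs↭ys)

sumℤ-map-applyDownFrom : ∀ {A : Set} (f : A → ℤ) (g : ℕ → A) N →
                         sumℤ (map f (applyDownFrom g N)) ≡ sumTo N (λ t → f (g (t ∸ 1)))
sumℤ-map-applyDownFrom f g zero    = refl
sumℤ-map-applyDownFrom f g (suc N) =
  trans (cong (λ s → f (g N) + s) (sumℤ-map-applyDownFrom f g N)) (ℤ.+-comm (f (g N)) _)

sumTo-cong : ∀ N {f g : ℕ → ℤ} → (∀ t → 1 ≤ t → t ≤ N → f t ≡ g t) → sumTo N f ≡ sumTo N g
sumTo-cong zero    f≗g = refl
sumTo-cong (suc N) f≗g =
  cong₂ _+_ (sumTo-cong N (λ t 1≤t t≤N → f≗g t 1≤t (≤-trans t≤N (n≤1+n N)))) (f≗g (suc N) (s≤s z≤n) ≤-refl)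

sumTo-sub : ∀ N (f g : ℕ → ℤ) → sumTo N (λ t → f t - g t) ≡ sumTo N f - sumTo N g
sumTo-sub zero    f g = refl
sumTo-sub (suc N) f g =
  trans (cong (_+ (f (suc N) - g (suc N))) (sumTo-sub N f g)) (ring (sumTo N f) (sumTo N g) (f (suc N)) (g (suc N)))
  where
  ring : ∀ a b c d → a - b + (c - d) ≡ a + c - (b + d)
  ring = solve-∀

sumTo-affine : ∀ N a b c (f : ℕ → ℤ) → sumTo N (λ t → a + (b * f t + c)) ≡ + N * a + (b * sumTo N f + + N * c)
sumTo-affine zero    a b c f = ring a b c
  where
  ring : ∀ a b c → + 0 ≡ + 0 * a + (b * + 0 + + 0 * c)
  ring = solve-∀
sumTo-affine (suc N) a b c f =
  trans (cong (_+ (a + (b * f (suc N) + c))) (sumTo-affine N a b c f)) (ring a b c (+ N) (sumTo N f) (f (suc N)))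
  where
  ring : ∀ a b c n s x → n * a + (b * s + n * c) + (a + (b * x + c)) ≡ (+ 1 + n) * a + (b * (s + x) + (+ 1 + n) * c)
  ring = solve-∀

sumTo-indicator-absent : ∀ i N → N < i → sumTo N (λ t → indicator (i ≡ᵇ t)) ≡ + 0
sumTo-indicator-absent i zero    _   = refl
sumTo-indicator-absent i (suc N) N<i =
  cong₂ _+_ (sumTo-indicator-absent i N (<-trans (n<1+n N) N<i)) (cong indicator (dec-false (i ≟ suc N) (≢-sym (<⇒≢ N<i))))

sumTo-indicator : ∀ i N → 1 ≤ i → i ≤ N → sumTo N (λ t → indicator (i ≡ᵇ t)) ≡ + 1
sumTo-indicator i zero    1≤i i≤0 = ⊥-elim (<⇒≱ 1≤i i≤0)
sumTo-indicator i (suc N) 1≤i i≤1+N with i ≟ suc N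
... | yes refl = cong₂ _+_ (sumTo-indicator-absent (suc N) N ≤-refl) (cong indicator (dec-true (suc N ≟ suc N) refl))
... | no i≢1+N =
  cong₂ _+_ (sumTo-indicator i N 1≤i (≤-pred (≤∧≢⇒< i≤1+N i≢1+N))) (cong indicator (dec-false (i ≟ suc N) i≢1+N))

sumTo-blockSlope : ∀ N p → BlockWithin N p → sumTo N (blockSlope p) ≡ + 0
sumTo-blockSlope N (i , j) (1≤i , i<j , j≤N) = begin
    sumTo N (blockSlope (i , j))
  ≡⟨ sumTo-sub N _ _ ⟩
    sumTo N (λ t → indicator (i ≡ᵇ t)) - sumTo N (λ t → indicator (j ≡ᵇ t))
  ≡⟨ cong₂ _-_ (sumTo-indicator i N 1≤i (≤-trans (<⇒≤ i<j) j≤N)) (sumTo-indicator j N (≤-trans 1≤i (<⇒≤ i<j)) j≤N) ⟩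
    + 0
  ∎
  where open ≡-Reasoning

sumTo-trapezoid : ∀ (bs : Labelled n) N →
                  sumTo N (trapezoid bs) + height bs N ≡ + 2 * sumTo (suc N) (λ t → height bs (t ∸ 1))
sumTo-trapezoid bs zero    = refl
sumTo-trapezoid bs (suc N) = begin
  sumTo N (trapezoid bs) + (h N + h (suc N)) + h (suc N)    ≡⟨ regroup (sumTo N (trapezoid bs)) (h N) (h (suc N)) ⟩
  sumTo N (trapezoid bs) + h N + + 2 * h (suc N)            ≡⟨ cong (_+ + 2 * h (suc N)) (sumTo-trapezoid bs N) ⟩
  + 2 * S + + 2 * h (suc N)                                 ≡⟨ ℤ.*-distribˡ-+ (+ 2) S (h (suc N)) ⟨
  + 2 * (S + h (suc N))                                     ∎
  where
  open ≡-Reasoning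
  h : ℕ → ℤ
  h = height bs
  S : ℤ
  S = sumTo (suc N) (λ t → h (t ∸ 1))
  regroup : ∀ s a b → s + (a + b) + b ≡ s + a + + 2 * b
  regroup = solve-∀

-- Heights and areas of children

slope-∷ʳ : (xs : Labelled n) (z : Pair) (t : ℕ) → slope (xs ∷ʳ z) t ≡ slope xs t + blockSlope z t
slope-∷ʳ []       z t = refl
slope-∷ʳ (y ∷ xs) z t = begin
  slope (xs ∷ʳ z) t + blockSlope y t                 ≡⟨ cong (_+ blockSlope y t) (slope-∷ʳ xs z t) ⟩
  slope xs t + blockSlope z t + blockSlope y t       ≡⟨ swap (slope xs t) (blockSlope z t) (blockSlope y t) ⟩
  slope xs t + blockSlope y t + blockSlope z t       ∎
  where
  open ≡-Reasoning
  swap : ∀ a b c → a + b + c ≡ a + c + b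
  swap = solve-∀

slope-map-shiftBlock : ∀ m t (ρ : Labelled n) → slope (mapᵥ (shiftBlock m) ρ) (shift m t) ≡ slope ρ t
slope-map-shiftBlock m t []      = refl
slope-map-shiftBlock m t (p ∷ ρ) =
  cong₂ _+_ (slope-map-shiftBlock m t ρ) (blockSlope-≡ (shiftBlock m p) (shift m t) (≡ᵇ-shift (proj₁ p)) (≡ᵇ-shift (proj₂ p)))
  where
  ≡ᵇ-shift : ∀ x → (shift m x ≡ᵇ shift m t) ≡ (x ≡ᵇ t)
  ≡ᵇ-shift x = does-⇔ (mk⇔ (shift-injective m) (cong (shift m))) (shift m x ≟ shift m t) (x ≟ t)

slope-map-shiftBlock-gap : ∀ m t → (∀ x → shift m x ≢ t) → (ρ : Labelled n) → slope (mapᵥ (shiftBlock m) ρ) t ≡ + 0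
slope-map-shiftBlock-gap m t gap []      = refl
slope-map-shiftBlock-gap m t gap (p ∷ ρ) =
  cong₂ _+_ (slope-map-shiftBlock-gap m t gap ρ)
            (blockSlope-≡ (shiftBlock m p) t (dec-false (_ ≟ t) (gap (proj₁ p))) (dec-false (_ ≟ t) (gap (proj₂ p))))

slope-child-shift : ∀ m t (ρ : Labelled k) → slope (child m ρ) (shift m t) ≡ slope ρ t
slope-child-shift m t ρ = begin
    slope (child m ρ) (shift m t)
  ≡⟨ slope-∷ʳ (mapᵥ (shiftBlock m) ρ) (m , suc m) (shift m t) ⟩
    slope (mapᵥ (shiftBlock m) ρ) (shift m t) + blockSlope (m , suc m) (shift m t)
  ≡⟨ cong₂ _+_ (slope-map-shiftBlock m t ρ) adjacent-flat ⟩
    slope ρ t + + 0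
  ≡⟨ ℤ.+-identityʳ (slope ρ t) ⟩
    slope ρ t
  ∎
  where
  open ≡-Reasoning
  adjacent-flat : blockSlope (m , suc m) (shift m t) ≡ + 0
  adjacent-flat = blockSlope-≡ (m , suc m) (shift m t) (dec-false (m ≟ shift m t) (proj₁ (shift≢ m t) ∘ sym))
                                                       (dec-false (suc m ≟ shift m t) (proj₂ (shift≢ m t) ∘ sym))

slope-child-up : ∀ m (ρ : Labelled k) → slope (child m ρ) m ≡ + 1
slope-child-up m ρ = trans (slope-∷ʳ (mapᵥ (shiftBlock m) ρ) (m , suc m) m)
  (cong₂ _+_ (slope-map-shiftBlock-gap m m (proj₁ ∘ shift≢ m) ρ)
             (blockSlope-≡ (m , suc m) m (dec-true (m ≟ m) refl) (dec-false (suc m ≟ m) (1+n≢n {m}))))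

slope-child-down : ∀ m (ρ : Labelled k) → slope (child m ρ) (suc m) ≡ - + 1
slope-child-down m ρ = trans (slope-∷ʳ (mapᵥ (shiftBlock m) ρ) (m , suc m) (suc m))
  (cong₂ _+_ (slope-map-shiftBlock-gap m (suc m) (proj₂ ∘ shift≢ m) ρ)
             (blockSlope-≡ (m , suc m) (suc m) (dec-false (m ≟ suc m) (≢-sym (1+n≢n {m}))) (dec-true (suc m ≟ suc m) refl)))

module _ (p : ℕ) (ρ : Labelled k) where

  private
    c : Labelled (suc k)
    c = child (suc p) ρ

  height-child-below : ∀ t → t ≤ p → height c t ≡ height ρ t
  height-child-below zero    _   = refl
  height-child-below (suc t) t<p =
    cong₂ _+_ (height-child-below t (<⇒≤ t<p))
              (trans (cong (slope c) (sym (shift-< (s≤s t<p)))) (slope-child-shift (suc p) (suc t) ρ))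

  height-child-peak : height c (suc p) ≡ height ρ p + + 1
  height-child-peak = cong₂ _+_ (height-child-below p ≤-refl) (slope-child-up (suc p) ρ)

  height-child-above : ∀ t → p ≤ t → height c (suc (suc t)) ≡ height ρ t
  height-child-above t p≤t with m≤n⇒m<n∨m≡n p≤t
  ... | inj₂ refl = trans (cong₂ _+_ height-child-peak (slope-child-down (suc p) ρ)) (cancel (height ρ p))
    where
    cancel : ∀ h → h + + 1 + - + 1 ≡ h
    cancel = solve-∀
  height-child-above (suc t) _ | inj₁ (s≤s p≤t) =
    cong₂ _+_ (height-child-above t p≤t)
              (trans (cong (slope c) (sym (shift-≥ (s≤s p≤t)))) (slope-child-shift (suc p) (suc t) ρ))

  sumTo-trapezoid-child-below : ∀ t → t ≤ p → sumTo t (trapezoid c) ≡ sumTo t (trapezoid ρ)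
  sumTo-trapezoid-child-below zero    _   = refl
  sumTo-trapezoid-child-below (suc t) t<p =
    cong₂ _+_ (sumTo-trapezoid-child-below t (<⇒≤ t<p))
              (cong₂ _+_ (height-child-below t (<⇒≤ t<p)) (height-child-below (suc t) t<p))

  sumTo-trapezoid-child-above : ∀ t → p ≤ t →
    sumTo (suc (suc t)) (trapezoid c) ≡ sumTo t (trapezoid ρ) + (+ 4 * height ρ p + + 2)
  sumTo-trapezoid-child-above t p≤t with m≤n⇒m<n∨m≡n p≤t
  ... | inj₂ refl =
    trans (cong₂ _+_ (cong₂ _+_ (sumTo-trapezoid-child-below p ≤-refl)
                                (cong₂ _+_ (height-child-below p ≤-refl) (height-child-peak)))
                     (cong₂ _+_ (height-child-peak) (height-child-above p ≤-refl)))
          (tent (sumTo p (trapezoid ρ)) (height ρ p))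
    where
    tent : ∀ s h → s + (h + (h + + 1)) + (h + + 1 + h) ≡ s + (+ 4 * h + + 2)
    tent = solve-∀
  sumTo-trapezoid-child-above (suc t) _ | inj₁ (s≤s p≤t) =
    trans (cong₂ _+_ (sumTo-trapezoid-child-above t p≤t)
                     (cong₂ _+_ (height-child-above t p≤t) (height-child-above (suc t) (≤-trans p≤t (n≤1+n t)))))
          (swap (sumTo t (trapezoid ρ)) _ (trapezoid ρ (suc t)))
    where
    swap : ∀ a b c → a + b + c ≡ a + c + b
    swap = solve-∀

twiceArea-child : ∀ p (ρ : Labelled k) → p ≤ 2 *ℕ k →
                  twiceArea (suc k) (child (suc p) ρ) ≡ twiceArea k ρ + (+ 4 * height ρ p + + 2)
twiceArea-child {k} p ρ p≤2k =
  trans (cong (λ N → sumTo N (trapezoid (child (suc p) ρ))) (*-suc 2 k)) (sumTo-trapezoid-child-above p ρ (2 *ℕ k) p≤2k)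

height-∷ : ∀ y (ys : Labelled n) N → height (y ∷ ys) N ≡ height ys N + sumTo N (blockSlope y)
height-∷ y ys zero    = refl
height-∷ y ys (suc N) =
  trans (cong (_+ (slope ys (suc N) + blockSlope y (suc N))) (height-∷ y ys N))
        (interchange (height ys N) (sumTo N (blockSlope y)) (slope ys (suc N)) (blockSlope y (suc N)))
  where
  interchange : ∀ a b c d → a + b + (c + d) ≡ a + c + (b + d)
  interchange = solve-∀

height-closed : ∀ N (bs : Labelled n) → (∀ i → BlockWithin N (lookup bs i)) → height bs N ≡ + 0
height-closed zero    []       _      = refl
height-closed (suc N) []       _      = cong (_+ + 0) (height-closed N [] λ ())
height-closed N       (y ∷ ys) within =
  trans (height-∷ y ys N) (cong₂ _+_ (height-closed N ys (within ∘ fsuc)) (sumTo-blockSlope N y (within fzero)))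

twiceArea≡2*sumHeights : ∀ (ρ : Labelled k) → NCmton k ρ →
                         twiceArea k ρ ≡ + 2 * sumTo (suc (2 *ℕ k)) (λ t → height ρ (t ∸ 1))
twiceArea≡2*sumHeights {k} ρ ((within , _) , _) = begin
  twiceArea k ρ                                        ≡⟨ ℤ.+-identityʳ (twiceArea k ρ) ⟨
  twiceArea k ρ + + 0                                  ≡⟨ cong (_+_ (twiceArea k ρ)) (height-closed (2 *ℕ k) ρ within) ⟨
  twiceArea k ρ + height ρ (2 *ℕ k)                    ≡⟨ sumTo-trapezoid ρ (2 *ℕ k) ⟩
  + 2 * sumTo (suc (2 *ℕ k)) (λ t → height ρ (t ∸ 1))  ∎
  where open ≡-Reasoning

recurrence-identity : ∀ K T S → T ≡ + 2 * S →
  (+ 1 + K) * T + (+ 4 * S + (+ 1 + K) * + 2) ≡ + 2 * (+ 1 + (+ 1 + K) - + 1) + (+ 1 + (+ 1 + K) + + 1) * T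
recurrence-identity K _ S refl = ring K S
  where
  ring : ∀ K S → (+ 1 + K) * (+ 2 * S) + (+ 4 * S + (+ 1 + K) * + 2)
               ≡ + 2 * (+ 1 + (+ 1 + K) - + 1) + (+ 1 + (+ 1 + K) + + 1) * (+ 2 * S)
  ring = solve-∀

lemma8p2 : (k : ℕ) → 1 ≤ k → (ρ : Labelled k) → NCmton k ρ →
    (cs : List (Labelled (suc k))) → Unique cs →
    (∀ (bs : Labelled (suc k)) → (bs ∈ cs) ⇔ (NCmton (suc k) bs × pp bs ≡ ρ)) →
    sumℤ (map (twiceArea (suc k)) cs)
      ≡ (+ 2) * (+ (2 *ℕ suc k) - + 1) + (+ (2 *ℕ suc k) + + 1) * twiceArea k ρ
lemma8p2 k _ ρ ncρ cs cs-unique cs-children = begin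
    sumℤ (map (twiceArea (suc k)) cs)
  ≡⟨ sumℤ-↭ (↭.map⁺ (twiceArea (suc k)) cs↭children) ⟩
    sumℤ (map (twiceArea (suc k)) (children ρ))
  ≡⟨ sumℤ-map-applyDownFrom (twiceArea (suc k)) (λ p → child (suc p) ρ) N ⟩
    sumTo N (λ t → twiceArea (suc k) (child (suc (t ∸ 1)) ρ))
  ≡⟨ sumTo-cong N (λ t _ t≤N → twiceArea-child (t ∸ 1) ρ (∸-monoˡ-≤ 1 t≤N)) ⟩
    sumTo N (λ t → T + (+ 4 * height ρ (t ∸ 1) + + 2))
  ≡⟨ sumTo-affine N T (+ 4) (+ 2) (λ t → height ρ (t ∸ 1)) ⟩
    + N * T + (+ 4 * S + + N * + 2)
  ≡⟨ recurrence-identity (+ (2 *ℕ k)) T S (twiceArea≡2*sumHeights ρ ncρ) ⟩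
    + 2 * (+ suc N - + 1) + (+ suc N + + 1) * T
  ≡⟨ cong (λ M → + 2 * (+ M - + 1) + (+ M + + 1) * T) (*-suc 2 k) ⟨
    + 2 * (+ (2 *ℕ suc k) - + 1) + (+ (2 *ℕ suc k) + + 1) * T
  ∎
  where
  open ≡-Reasoning
  N : ℕ
  N = suc (2 *ℕ k)
  T S : ℤ
  T = twiceArea k ρ
  S = sumTo N (λ t → height ρ (t ∸ 1))
  cs↭children : cs ↭ children ρ
  cs↭children = ∼bag⇒↭ (unique∧set⇒bag cs-unique (children-unique ρ)
                          (λ {bs} → ⇔-trans (cs-children bs) (⇔-sym (∈-children⇔ ncρ bs))))
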